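{- Let $G$ be a graph, let $\mathcal C$ be a collection of cycles in $G$, and let $\mathcal H$ be a collection of pairwise vertex-disjoint subgraphs of $G$. Let $G'$ be the $\mathcal C$-framing of $G$, and for each $H\in\mathcal H$ let $H'$ be the $\mathcal C$-framing of $H$ (with the new vertices added for distinct members of $\mathcal H$ taken to be distinct). Then the graph $\bigcup_{H\in\mathcal H} H'$ is isomorphic to a subgraph of $G'$.
   Context: For $s,t\geq 1$, the $(s\times t)$-grid is the Cartesian product of the path on $s$ vertices $P$ with the path on $t$ vertices $Q$; fixing an endpoint $v$ of $P$, its top is the copy $\{v\}\times Q$. For $r\geq1$, $k\geq 3$, the $(r\times k)$-cylinder is the Cartesian product of the path $P$ on $r$ vertices with the cycle on $k$ vertices $C$; fixing an endpoint $v$ of $P$, its top is $\{v\}\times C$. Let $\mathcal C=\{C_1,\ldots,C_k\}$ be cycles in $G$ and $H\subseteq G$ a subgraph. The $\mathcal C$-framing of $H$ is obtained from $H$ as follows: for each $C_i$, if $C_i\subseteq H$, take a new copy of the $(3\times|V(C_i)|)$-cylinder and identify its top with $C_i$ (respecting the cyclic order); otherwise, for each maximal subpath $P_j$ of $C_i$ contained in $H$, take a new copy of the $(3\times|V(P_j)|)$-grid and identify its top with $P_j$ (respecting the order along the path). The $\mathcal C$-framing of $G$ is the case $H=G$. -}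

module Defs where

open import Data.Nat using (ℕ; suc; _≤_)
open import Data.Nat.DivMod using (_%_; m%n<n)
open import Data.Fin using (Fin; zero; suc; toℕ; fromℕ<)
open import Data.Bool using (Bool; true; false; T)
open import Data.Product using (Σ; ∃; _×_; _,_)
open import Data.Sum using (_⊎_; inj₁; inj₂)
open import Relation.Binary.PropositionalEquality using (_≡_)
open import Relation.Nullary using (¬_)
open import Function.Definitions using (Injective)
open import Function.Bundles using (_⇔_)

record SimpleGraph : Set where
  field
    N     : ℕ
    adj   : Fin N → Fin N → Bool
    sym   : ∀ u v → adj u v ≡ adj v u
    irref : ∀ v → adj v v ≡ false
open SimpleGraph public

next : ∀ {n} → Fin n → Fin n
next {suc n} i = fromℕ< (m%n<n (suc (toℕ i)) (suc n))

record Cycle (G : SimpleGraph) : Set where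
  field
    len  : ℕ
    len≥3 : 3 ≤ len
    vtx  : Fin len → Fin (N G)
    inj  : Injective _≡_ _≡_ vtx
    isAdj : ∀ p → T (adj G (vtx p) (vtx (next p)))
open Cycle public

CycleEdge : ∀ {G} → Cycle G → Fin (N G) → Fin (N G) → Set
CycleEdge c u v = ∃ λ p → (vtx c p ≡ u × vtx c (next p) ≡ v) ⊎ (vtx c p ≡ v × vtx c (next p) ≡ u)

SameCycle : ∀ {G} → Cycle G → Cycle G → Set
SameCycle c d =
  (∀ v → (∃ λ p → vtx c p ≡ v) ⇔ (∃ λ q → vtx d q ≡ v)) ×
  (∀ u v → CycleEdge c u v ⇔ CycleEdge d u v)

record Subgraph (G : SimpleGraph) : Set where
  field
    inV : Fin (N G) → Bool
    inE : Fin (N G) → Fin (N G) → Bool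
    inE-sym : ∀ u v → inE u v ≡ inE v u
    inE-ok  : ∀ u v → T (inE u v) → T (adj G u v) × T (inV u) × T (inV v)
open Subgraph public

whole : (G : SimpleGraph) → Subgraph G
whole G = record
  { inV = λ _ → true
  ; inE = adj G
  ; inE-sym = sym G
  ; inE-ok = λ u v e → e , _ , _ }

module Framing (G : SimpleGraph) {m : ℕ} (C : Fin m → Cycle G) (H : Subgraph G) where

  -- Vertices of the C-framing of H: the vertices of H, plus, for every cycle C i
  -- and every position p of C i whose vertex lies in H, two new vertices
  -- (the layers 1 and 2 = zero, suc zero of the attached cylinder / grid column;
  -- layer 0 is the vertex of H itself, identified with the top).
  data FV : Set where
    old : (v : Fin (N G)) → T (inV H v) → FV
    new : (i : Fin m) (p : Fin (len (C i))) → T (inV H (vtx (C i) p)) → Fin 2 → FV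

  -- Edges: edges of H; vertical edges of each column; horizontal edges in
  -- layers 1,2 along every edge of C i that belongs to H.  (If C i ⊆ H this is the
  -- (3 × |C i|)-cylinder; otherwise the columns split exactly into the
  -- (3 × |P j|)-grids over the maximal subpaths P j of C i contained in H.)
  data FAdj : FV → FV → Set where
    orig  : ∀ {u v hu hv} → T (inE H u v) → FAdj (old u hu) (old v hv)
    down  : ∀ {i p hu h} → FAdj (old (vtx (C i) p) hu) (new i p h zero)
    up    : ∀ {i p hu h} → FAdj (new i p h zero) (old (vtx (C i) p) hu)
    vert  : ∀ {i p h} → FAdj (new i p h zero) (new i p h (suc zero))
    vert' : ∀ {i p h} → FAdj (new i p h (suc zero)) (new i p h zero)
    horiz  : ∀ {i p h h' l} → T (inE H (vtx (C i) p) (vtx (C i) (next p))) →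
             FAdj (new i p h l) (new i (next p) h' l)
    horiz' : ∀ {i p h h' l} → T (inE H (vtx (C i) p) (vtx (C i) (next p))) →
             FAdj (new i (next p) h' l) (new i p h l)

-- Since the members are vertex-disjoint,
-- this union is the disjoint union.
module UnionFraming (G : SimpleGraph) {m n : ℕ} (C : Fin m → Cycle G) (ℋ : Fin n → Subgraph G) where
  open Framing G C

  UV : Set
  UV = Σ (Fin n) λ j → FV (ℋ j)

  data UAdj : UV → UV → Set where
    inside : ∀ {j x y} → FAdj (ℋ j) x y → UAdj (j , x) (j , y)

IsoToSubgraph : (VA : Set) (EA : VA → VA → Set) (VB : Set) (EB : VB → VB → Set) → Set
IsoToSubgraph VA EA VB EB =
  Σ (VA → VB) λ φ → Injective _≡_ _≡_ φ × (∀ x y → EA x y → EB (φ x) (φ y))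

-- Framing is monotone: if H ⊆ K, every vertex and edge of the C-framing of H is
-- a vertex and edge of the C-framing of K, because the new vertices are indexed
-- only by a cycle and a position on it.  Each vertex of a framing lies over a
-- vertex of its base subgraph, so for vertex-disjoint members of ℋ these
-- embeddings have disjoint images and glue to an embedding of the union.
module Submission where

open import Defs hiding (sym)
open import Data.Nat using (ℕ)
open import Data.Fin using (Fin)
open import Data.Fin.Properties using (_≟_)
open import Data.Bool using (T)
open import Data.Bool.Properties using (T-irrelevant)
open import Data.Product using (_,_; proj₁)
open import Function.Definitions using (Injective)
open import Relation.Binary.PropositionalEquality using (_≡_; _≢_; refl; sym; cong; subst; module ≡-Reasoning)
open import Function.Base using (_∘_)
open import Relation.Nullary using (¬_; yes; no)
open import Data.Empty using (⊥; ⊥-elim)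

record _⊑_ {G : SimpleGraph} (H K : Subgraph G) : Set where
  field
    vertex-⊑ : ∀ v → T (inV H v) → T (inV K v)
    edge-⊑   : ∀ u v → T (inE H u v) → T (inE K u v)
open _⊑_

⊑-whole : {G : SimpleGraph} (H : Subgraph G) → H ⊑ whole G
⊑-whole H = record
  { vertex-⊑ = λ _ _ → _
  ; edge-⊑   = λ u v e → proj₁ (inE-ok H u v e) }

index-unique : {G : SimpleGraph} {n : ℕ} (ℋ : Fin n → Subgraph G) →
  (∀ j j' v → j ≢ j' → T (inV (ℋ j) v) → T (inV (ℋ j') v) → ⊥) →
  ∀ {j j' v} → T (inV (ℋ j) v) → T (inV (ℋ j') v) → j ≡ j'
index-unique ℋ disjoint {j} {j'} {v} v∈j v∈j' with j ≟ j'
... | yes j≡j' = j≡j'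
... | no  j≢j' = ⊥-elim (disjoint j j' v j≢j' v∈j v∈j')

module _ (G : SimpleGraph) {m : ℕ} (C : Fin m → Cycle G) where
  open Framing G C

  base : {H : Subgraph G} → FV H → Fin (N G)
  base (old v _)     = v
  base (new i p _ _) = vtx (C i) p

  base-∈ : {H : Subgraph G} (x : FV H) → T (inV H (base x))
  base-∈ (old _ v∈H)     = v∈H
  base-∈ (new _ _ v∈H _) = v∈H

  module _ {H K : Subgraph G} (H⊑K : H ⊑ K) where

    framing-map : FV H → FV K
    framing-map (old v v∈H)     = old v (vertex-⊑ H⊑K v v∈H)
    framing-map (new i p v∈H l) = new i p (vertex-⊑ H⊑K _ v∈H) l

    -- The membership proofs in the images are neutral, so they are abstracted
    -- before matching on eq; T-irrelevant then identifies the originals.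
    framing-map-injective : Injective _≡_ _≡_ framing-map
    framing-map-injective {old v a} {old w b} eq
      with vertex-⊑ H⊑K v a | vertex-⊑ H⊑K w b | eq
    ... | _ | _ | refl rewrite T-irrelevant a b = refl
    framing-map-injective {new i p a _} {new j q b _} eq
      with vertex-⊑ H⊑K (vtx (C i) p) a | vertex-⊑ H⊑K (vtx (C j) q) b | eq
    ... | _ | _ | refl rewrite T-irrelevant a b = refl

    base-framing-map : ∀ x → base (framing-map x) ≡ base x
    base-framing-map (old _ _)     = refl
    base-framing-map (new _ _ _ _) = refl

    framing-map-adj : ∀ {x y} → FAdj H x y → FAdj K (framing-map x) (framing-map y)
    framing-map-adj (orig e)   = orig (edge-⊑ H⊑K _ _ e)
    framing-map-adj down       = down
    framing-map-adj up         = up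
    framing-map-adj vert       = vert
    framing-map-adj vert'      = vert'
    framing-map-adj (horiz e)  = horiz (edge-⊑ H⊑K _ _ e)
    framing-map-adj (horiz' e) = horiz' (edge-⊑ H⊑K _ _ e)

  union-framing-embeds : {n : ℕ} (ℋ : Fin n → Subgraph G) (K : Subgraph G) →
    (∀ j → ℋ j ⊑ K) →
    (∀ j j' v → j ≢ j' → T (inV (ℋ j) v) → T (inV (ℋ j') v) → ⊥) →
    IsoToSubgraph (UnionFraming.UV G C ℋ) (UnionFraming.UAdj G C ℋ) (FV K) (FAdj K)
  union-framing-embeds ℋ K ℋ⊑K disjoint = φ , φ-injective , φ-adj
    where
    open UnionFraming G C ℋ
    open ≡-Reasoning

    φ : UV → FV K
    φ (j , x) = framing-map (ℋ⊑K j) x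

    φ-injective : Injective _≡_ _≡_ φ
    φ-injective {j , x} {j' , y} φx≡φy
      with index-unique ℋ disjoint (base-∈ x) base-x∈ℋj'
      where
      base-x≡base-y : base x ≡ base y
      base-x≡base-y = begin
        base x                        ≡⟨ sym (base-framing-map (ℋ⊑K j) x) ⟩
        base (framing-map (ℋ⊑K j) x)  ≡⟨ cong base φx≡φy ⟩
        base (framing-map (ℋ⊑K j') y) ≡⟨ base-framing-map (ℋ⊑K j') y ⟩
        base y                        ∎

      base-x∈ℋj' : T (inV (ℋ j') (base x))
      base-x∈ℋj' = subst (T ∘ inV (ℋ j')) (sym base-x≡base-y) (base-∈ y)
    ... | refl = cong (j ,_) (framing-map-injective (ℋ⊑K j) φx≡φy)

    φ-adj : ∀ x y → UAdj x y → FAdj K (φ x) (φ y)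
    φ-adj _ _ (inside {j} e) = framing-map-adj (ℋ⊑K j) e

lemma4p6 : (G : SimpleGraph) {m n : ℕ} (C : Fin m → Cycle G) (ℋ : Fin n → Subgraph G) →
    (∀ i i' → i ≢ i' → ¬ SameCycle (C i) (C i')) →
    (∀ j j' v → j ≢ j' → T (inV (ℋ j) v) → T (inV (ℋ j') v) → ⊥) →
    IsoToSubgraph (UnionFraming.UV G C ℋ) (UnionFraming.UAdj G C ℋ)
    (Framing.FV G C (whole G)) (Framing.FAdj G C (whole G))
lemma4p6 G C ℋ _ disjoint =
  union-framing-embeds G C ℋ (whole G) (λ j → ⊑-whole (ℋ j)) disjoint
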